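{- Let $m\ge1$ be an integer and $\mathbf t=(\infty,\ldots,\infty)\in\overline{\mathbb N}_+^{2m}$. Then $\mathfrak B_m(0)=c_{\mathbf t}>\tfrac12$.
   Context: Let $\overline{\mathbb N}_+=\{1,2,3,\ldots\}\cup\{\infty\}$. Let $\alpha,\beta$ be formal variables, $A_0^\infty=\begin{pmatrix}1&0\\ \frac{\alpha}{1-\beta}&0\end{pmatrix}$, $A_1^\infty=\begin{pmatrix}0&\frac{\beta}{1-\alpha}\\0&1\end{pmatrix}$ over $\mathbb C[[\alpha,\beta]]$. For $\mathbf t=(\infty,\ldots,\infty)\in\overline{\mathbb N}_+^{2m}$, $\gamma_{\mathbf t}(\alpha,\beta)$ is the top-left entry of $(A_1^\infty A_0^\infty)^m$, and $c_{\mathbf t}=\sum_{i\ge j\ge0}2^{ -(i+j)}[\alpha^i\beta^j]\gamma_{\mathbf t}(\alpha,\beta)$. For $a\in\mathbb Z$, $\mathfrak B_m(a)=\sum_{i,j\ge0,\ i-j\ge a}2^{ -(i+j)}[\alpha^i\beta^j]\left(\frac{\alpha\beta}{(1-\alpha)(1-\beta)}\right)^m$. -}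

module Defs where

open import Data.Nat using (ℕ; zero; suc; _≤ᵇ_)
open import Data.Integer using (ℤ; +_) renaming (_-_ to _-ℤ_; _≤ᵇ_ to _≤ℤᵇ_)
open import Data.Rational using (ℚ; 0ℚ; 1ℚ; ½; _+_; _*_; _≤_; _<_)
open import Data.Bool using (Bool; true; false; if_then_else_)
open import Data.Fin using (Fin; zero; suc)
open import Data.Product using (_×_; ∃)

-- Formal power series in two variables α, β with rational coefficients:
-- a power series is its coefficient function, f i j = [α^i β^j] f.
-- (All series in the statement have rational coefficients, so ℚ[[α,β]]
-- ⊆ ℂ[[α,β]] suffices.)

PS : Set
PS = ℕ → ℕ → ℚ

Σ≤ : ℕ → (ℕ → ℚ) → ℚ
Σ≤ zero    f = f 0
Σ≤ (suc n) f = Σ≤ n f + f (suc n)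

_⊕_ : PS → PS → PS
(f ⊕ g) i j = f i j + g i j

_⊛_ : PS → PS → PS
(f ⊛ g) i j = Σ≤ i (λ a → Σ≤ j (λ b → f a b * g (i Data.Nat.∸ a) (j Data.Nat.∸ b)))

zeroPS : PS
zeroPS _ _ = 0ℚ

onePS : PS
onePS zero zero = 1ℚ
onePS _    _    = 0ℚ

αPS : PS
αPS (suc zero) zero = 1ℚ
αPS _          _    = 0ℚ

βPS : PS
βPS zero (suc zero) = 1ℚ
βPS _    _          = 0ℚ

-- the inverses 1/(1-α) = Σ_k α^k and 1/(1-β) = Σ_k β^k in ℚ[[α,β]]
inv1-α : PS
inv1-α _ zero    = 1ℚ
inv1-α _ (suc _) = 0ℚ

inv1-β : PS
inv1-β zero    _ = 1ℚ
inv1-β (suc _) _ = 0ℚ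

Mat2 : Set
Mat2 = Fin 2 → Fin 2 → PS

_⊗_ : Mat2 → Mat2 → Mat2
(A ⊗ B) r c = (A r zero ⊛ B zero c) ⊕ (A r (suc zero) ⊛ B (suc zero) c)

idMat : Mat2
idMat zero       zero       = onePS
idMat (suc zero) (suc zero) = onePS
idMat _          _          = zeroPS

_^M_ : Mat2 → ℕ → Mat2
A ^M zero  = idMat
A ^M suc n = A ⊗ (A ^M n)

A0∞ : Mat2
A0∞ zero       zero       = onePS
A0∞ zero       (suc zero) = zeroPS
A0∞ (suc zero) zero       = αPS ⊛ inv1-β
A0∞ (suc zero) (suc zero) = zeroPS

A1∞ : Mat2
A1∞ zero       zero       = zeroPS
A1∞ zero       (suc zero) = βPS ⊛ inv1-α
A1∞ (suc zero) zero       = zeroPS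
A1∞ (suc zero) (suc zero) = onePS

-- γ_t(α,β) for t = (∞,…,∞) ∈ N̄₊^{2m}: top-left entry of (A₁^∞ A₀^∞)^m
γ∞ : ℕ → PS
γ∞ m = ((A1∞ ⊗ A0∞) ^M m) zero zero

½^ : ℕ → ℚ
½^ zero    = 1ℚ
½^ (suc k) = ½ * ½^ k

cTerm : ℕ → ℕ → ℕ → ℚ
cTerm m i j = if j ≤ᵇ i then ½^ (i Data.Nat.+ j) * γ∞ m i j else 0ℚ

powPS : PS → ℕ → PS
powPS f zero    = onePS
powPS f (suc n) = f ⊛ powPS f n

ratioPS : PS
ratioPS = (αPS ⊛ βPS) ⊛ (inv1-α ⊛ inv1-β)

BTerm : ℕ → ℤ → ℕ → ℕ → ℚ
BTerm m a i j = if a ≤ℤᵇ ((+ i) -ℤ (+ j)) then ½^ (i Data.Nat.+ j) * powPS ratioPS m i j else 0ℚ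

-- Sums over ℕ × ℕ of families of nonnegative rationals, valued in [0,∞],
-- are the suprema of the finite partial sums over boxes [0,N]².

box : (ℕ → ℕ → ℚ) → ℕ → ℚ
box f N = Σ≤ N (λ i → Σ≤ N (λ j → f i j))

SumEq : (ℕ → ℕ → ℚ) → (ℕ → ℕ → ℚ) → Set
SumEq f g = (∀ N → ∃ λ M → box f N ≤ box g M)
          × (∀ N → ∃ λ M → box g N ≤ box f M)

SumGt : (ℕ → ℕ → ℚ) → ℚ → Set
SumGt f q = ∃ λ N → q < box f N

-- Both γ_t and (αβ/((1-α)(1-β)))^m factor as u(α) u(β) with u(x) = (x/(1-x))^m, and
-- i - j ≥ 0 is j ≤ i, so 𝔅_m(0) and c_t have the same summands.  The coefficient of x^i
-- in u is the number of compositions of i into m parts, so v_i = 2^{-i} [x^i] u is the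
-- probability that the m-th head of a fair coin appears at toss i; hence Σ v_i = 1 and
-- c_t = Σ_{j≤i} v_i v_j = ((Σ v_i)² + Σ v_i²)/2 ≥ ½ + ½ v_m² = ½ + 2^{-2m-1}.  On the box
-- [0,N]² the missing mass 1 - Σ_{i≤N} v_i is at most 2^m (3/4)^N, which for N = 8m+3 is
-- too small to cancel the excess 2^{-2m-1}.

module Submission where

open import Defs
open import Data.Nat using (ℕ; _≤_)
open import Data.Integer using (+_)
open import Data.Rational using (½)
open import Data.Product using (_×_)

open import Algebra.Bundles using (CommutativeMonoid)
import Algebra.Properties.CommutativeSemigroup as CommSemigroupProperties
open import Data.Bool using (true; false; if_then_else_)
open import Data.Nat using (zero; suc; _<_; _∸_; z≤n; s≤s)
import Data.Nat as ℕ
import Data.Nat.Properties as ℕ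
import Data.Integer as ℤ
import Data.Integer.Properties as ℤ
open import Data.Product using (_,_)
open import Data.Rational
  using (ℚ; 0ℚ; 1ℚ; _+_; _*_; _-_; _/_; nonNegative; nonPositive)
  renaming (_≤_ to _≤ℚ_; _<_ to _<ℚ_)
import Data.Rational.Properties as ℚ
open import Data.Rational.Solver using (module +-*-Solver)
open import Data.Sum using (inj₁; inj₂)
open import Data.Empty using (⊥-elim)
import Data.Fin as Fin
open import Function using (_∘_)
open import Relation.Binary.PropositionalEquality
open import Relation.Nullary.Decidable using (yes; no; toWitness)
open import Relation.Nullary.Reflects using (ofʸ; ofⁿ)

open import Algebra.Definitions.RawSemiring ℚ.+-*-rawSemiring using (_^_)
open CommSemigroupProperties (CommutativeMonoid.commutativeSemigroup ℚ.+-0-commutativeMonoid)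
  using () renaming (interchange to +-interchange)
open CommSemigroupProperties (CommutativeMonoid.commutativeSemigroup ℚ.*-1-commutativeMonoid)
  using () renaming (interchange to *-interchange)

Σ≤-congᵇ : ∀ n {f g : ℕ → ℚ} → (∀ k → k ≤ n → f k ≡ g k) → Σ≤ n f ≡ Σ≤ n g
Σ≤-congᵇ zero    f≡g = f≡g 0 z≤n
Σ≤-congᵇ (suc n) f≡g =
  cong₂ _+_ (Σ≤-congᵇ n (λ k k≤n → f≡g k (ℕ.m≤n⇒m≤1+n k≤n))) (f≡g (suc n) ℕ.≤-refl)

Σ≤-cong : ∀ n {f g : ℕ → ℚ} → f ≗ g → Σ≤ n f ≡ Σ≤ n g
Σ≤-cong n f≗g = Σ≤-congᵇ n (λ k _ → f≗g k)

Σ≤-sucˡ : ∀ n (f : ℕ → ℚ) → Σ≤ (suc n) f ≡ f 0 + Σ≤ n (f ∘ suc)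
Σ≤-sucˡ zero    f = refl
Σ≤-sucˡ (suc n) f = begin
  Σ≤ (suc n) f + f (suc (suc n))            ≡⟨ cong (_+ f (suc (suc n))) (Σ≤-sucˡ n f) ⟩
  (f 0 + Σ≤ n (f ∘ suc)) + f (suc (suc n))  ≡⟨ ℚ.+-assoc (f 0) _ _ ⟩
  f 0 + Σ≤ (suc n) (f ∘ suc)                ∎
  where open ≡-Reasoning

*-distribˡ-Σ≤ : ∀ n c (f : ℕ → ℚ) → c * Σ≤ n f ≡ Σ≤ n (λ k → c * f k)
*-distribˡ-Σ≤ zero    c f = refl
*-distribˡ-Σ≤ (suc n) c f =
  trans (ℚ.*-distribˡ-+ c (Σ≤ n f) (f (suc n))) (cong (_+ c * f (suc n)) (*-distribˡ-Σ≤ n c f))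

*-distribʳ-Σ≤ : ∀ n c (f : ℕ → ℚ) → Σ≤ n f * c ≡ Σ≤ n (λ k → f k * c)
*-distribʳ-Σ≤ zero    c f = refl
*-distribʳ-Σ≤ (suc n) c f =
  trans (ℚ.*-distribʳ-+ c (Σ≤ n f) (f (suc n))) (cong (_+ f (suc n) * c) (*-distribʳ-Σ≤ n c f))

Σ≤-distrib-+ : ∀ n (f g : ℕ → ℚ) → Σ≤ n (λ k → f k + g k) ≡ Σ≤ n f + Σ≤ n g
Σ≤-distrib-+ zero    f g = refl
Σ≤-distrib-+ (suc n) f g =
  trans (cong (_+ (f (suc n) + g (suc n))) (Σ≤-distrib-+ n f g)) (+-interchange (Σ≤ n f) (Σ≤ n g) (f (suc n)) (g (suc n)))

Σ≤-*-Σ≤ : ∀ m n (f g : ℕ → ℚ) → Σ≤ m (λ a → Σ≤ n (λ b → f a * g b)) ≡ Σ≤ m f * Σ≤ n g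
Σ≤-*-Σ≤ m n f g =
  trans (Σ≤-cong m (λ a → sym (*-distribˡ-Σ≤ n (f a) g))) (sym (*-distribʳ-Σ≤ m (Σ≤ n g) f))

Σ≤-zero : ∀ n (f : ℕ → ℚ) → (∀ k → k ≤ n → f k ≡ 0ℚ) → Σ≤ n f ≡ 0ℚ
Σ≤-zero zero    f f≡0 = f≡0 0 z≤n
Σ≤-zero (suc n) f f≡0 =
  cong₂ _+_ (Σ≤-zero n f (λ k k≤n → f≡0 k (ℕ.m≤n⇒m≤1+n k≤n))) (f≡0 (suc n) ℕ.≤-refl)

Σ≤-single : ∀ n p (f : ℕ → ℚ) → p ≤ n → (∀ k → k ≤ n → k ≢ p → f k ≡ 0ℚ) → Σ≤ n f ≡ f p
Σ≤-single zero    .zero f z≤n f≡0 = refl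
Σ≤-single (suc n) p     f p≤  f≡0 with p ℕ.≟ suc n
... | yes refl = trans (cong (_+ f (suc n)) (Σ≤-zero n f below)) (ℚ.+-identityˡ _)
  where
  below : ∀ k → k ≤ n → f k ≡ 0ℚ
  below k k≤n = f≡0 k (ℕ.m≤n⇒m≤1+n k≤n) (ℕ.<⇒≢ (s≤s k≤n))
... | no p≢ = trans (cong₂ _+_ (Σ≤-single n p f p≤n (λ k k≤n → f≡0 k (ℕ.m≤n⇒m≤1+n k≤n)))
                               (f≡0 (suc n) ℕ.≤-refl (p≢ ∘ sym)))
                    (ℚ.+-identityʳ _)
  where p≤n = ℕ.≤-pred (ℕ.≤∧≢⇒< p≤ p≢)

Σ≤-truncate : ∀ n p (f : ℕ → ℚ) → p ≤ n → (∀ k → p < k → f k ≡ 0ℚ) → Σ≤ n f ≡ Σ≤ p f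
Σ≤-truncate zero    .zero f z≤n f≡0 = refl
Σ≤-truncate (suc n) p     f p≤  f≡0 with p ℕ.≟ suc n
... | yes refl = refl
... | no p≢ = trans (cong₂ _+_ (Σ≤-truncate n p f (ℕ.≤-pred p<1+n) f≡0) (f≡0 (suc n) p<1+n))
                    (ℚ.+-identityʳ _)
  where p<1+n = ℕ.≤∧≢⇒< p≤ p≢

0≤* : ∀ {p q} → 0ℚ ≤ℚ p → 0ℚ ≤ℚ q → 0ℚ ≤ℚ p * q
0≤* {p} {q} 0≤p 0≤q =
  ℚ.nonNegative⁻¹ (p * q) {{ℚ.nonNeg*nonNeg⇒nonNeg p {{nonNegative 0≤p}} q {{nonNegative 0≤q}}}}

0≤x*x : ∀ x → 0ℚ ≤ℚ x * x
0≤x*x x with ℚ.≤-total 0ℚ x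
... | inj₁ 0≤x = 0≤* 0≤x 0≤x
... | inj₂ x≤0 = ℚ.nonNegative⁻¹ (x * x)
  {{ℚ.nonPos*nonPos⇒nonPos x {{nonPositive x≤0}} x {{nonPositive x≤0}}}}

p≤p+q : ∀ {p q} → 0ℚ ≤ℚ q → p ≤ℚ p + q
p≤p+q {p} 0≤q = ℚ.≤-trans (ℚ.≤-reflexive (sym (ℚ.+-identityʳ p))) (ℚ.+-monoʳ-≤ p 0≤q)

p≤q+p : ∀ {p q} → 0ℚ ≤ℚ q → p ≤ℚ q + p
p≤q+p {p} 0≤q = ℚ.≤-trans (ℚ.≤-reflexive (sym (ℚ.+-identityˡ p))) (ℚ.+-monoˡ-≤ p 0≤q)

Σ≤-nonNeg : ∀ n {f : ℕ → ℚ} → (∀ k → 0ℚ ≤ℚ f k) → 0ℚ ≤ℚ Σ≤ n f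
Σ≤-nonNeg zero    0≤f = 0≤f 0
Σ≤-nonNeg (suc n) 0≤f = ℚ.+-mono-≤ (Σ≤-nonNeg n 0≤f) (0≤f (suc n))

term≤Σ≤ : ∀ n p {f : ℕ → ℚ} → (∀ k → 0ℚ ≤ℚ f k) → p ≤ n → f p ≤ℚ Σ≤ n f
term≤Σ≤ zero    .zero 0≤f z≤n = ℚ.≤-refl
term≤Σ≤ (suc n) p     0≤f p≤ with p ℕ.≟ suc n
... | yes refl = p≤q+p (Σ≤-nonNeg n 0≤f)
... | no p≢ = ℚ.≤-trans (term≤Σ≤ n p 0≤f (ℕ.≤-pred (ℕ.≤∧≢⇒< p≤ p≢))) (p≤p+q (0≤f (suc n)))

conv : (ℕ → ℚ) → (ℕ → ℚ) → ℕ → ℚ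
conv f g n = Σ≤ n (λ a → f a * g (n ∸ a))

δ₀ δ₁ geometric shiftedGeometric : ℕ → ℚ
δ₀ zero    = 1ℚ
δ₀ (suc _) = 0ℚ
δ₁ (suc zero) = 1ℚ
δ₁ _          = 0ℚ
geometric _ = 1ℚ
shiftedGeometric zero    = 0ℚ
shiftedGeometric (suc _) = 1ℚ

δ₀-∸ : ∀ n k → k ≤ n → k ≢ n → δ₀ (n ∸ k) ≡ 0ℚ
δ₀-∸ zero    .zero   z≤n       k≢n = ⊥-elim (k≢n refl)
δ₀-∸ (suc n) zero    _         _   = refl
δ₀-∸ (suc n) (suc k) (s≤s k≤n) k≢n = δ₀-∸ n k k≤n (k≢n ∘ cong suc)

δ₁-∸ : ∀ n k → k ≢ n → δ₁ (suc n ∸ k) ≡ 0ℚ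
δ₁-∸ zero    zero          k≢n = ⊥-elim (k≢n refl)
δ₁-∸ (suc n) zero          _   = refl
δ₁-∸ zero    (suc zero)    _   = refl
δ₁-∸ zero    (suc (suc k)) _   = refl
δ₁-∸ (suc n) (suc k)       k≢n = δ₁-∸ n k (k≢n ∘ cong suc)

conv-identityʳ : ∀ f → conv f δ₀ ≗ f
conv-identityʳ f n = begin
  conv f δ₀ n         ≡⟨ Σ≤-single n n _ ℕ.≤-refl off-diagonal ⟩
  f n * δ₀ (n ∸ n)    ≡⟨ cong (λ k → f n * δ₀ k) (ℕ.n∸n≡0 n) ⟩
  f n * 1ℚ            ≡⟨ ℚ.*-identityʳ (f n) ⟩
  f n                 ∎
  where
  open ≡-Reasoning
  off-diagonal : ∀ k → k ≤ n → k ≢ n → f k * δ₀ (n ∸ k) ≡ 0ℚ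
  off-diagonal k k≤n k≢n = trans (cong (f k *_) (δ₀-∸ n k k≤n k≢n)) (ℚ.*-zeroʳ (f k))

conv-identityˡ : ∀ f → conv δ₀ f ≗ f
conv-identityˡ f n = trans (Σ≤-single n 0 _ z≤n off-diagonal) (ℚ.*-identityˡ (f n))
  where
  off-diagonal : ∀ k → k ≤ n → k ≢ 0 → δ₀ k * f (n ∸ k) ≡ 0ℚ
  off-diagonal zero    _ k≢0 = ⊥-elim (k≢0 refl)
  off-diagonal (suc k) _ _   = ℚ.*-zeroˡ (f (n ∸ suc k))

conv-δ₁-geometric : conv δ₁ geometric ≗ shiftedGeometric
conv-δ₁-geometric zero    = refl
conv-δ₁-geometric (suc n) = Σ≤-single (suc n) 1 _ (s≤s z≤n) off-diagonal
  where
  off-diagonal : ∀ k → k ≤ suc n → k ≢ 1 → δ₁ k * 1ℚ ≡ 0ℚ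
  off-diagonal zero          _ _   = refl
  off-diagonal (suc zero)    _ k≢1 = ⊥-elim (k≢1 refl)
  off-diagonal (suc (suc k)) _ _   = refl

conv-geometric-δ₁ : conv geometric δ₁ ≗ shiftedGeometric
conv-geometric-δ₁ zero    = refl
conv-geometric-δ₁ (suc n) = begin
  conv geometric δ₁ (suc n)  ≡⟨ Σ≤-single (suc n) n _ (ℕ.n≤1+n n) off-diagonal ⟩
  1ℚ * δ₁ (suc n ∸ n)        ≡⟨ cong (λ k → 1ℚ * δ₁ k) (ℕ.m+n∸n≡m 1 n) ⟩
  1ℚ                         ∎
  where
  open ≡-Reasoning
  off-diagonal : ∀ k → k ≤ suc n → k ≢ n → 1ℚ * δ₁ (suc n ∸ k) ≡ 0ℚ
  off-diagonal k _ k≢n = cong (1ℚ *_) (δ₁-∸ n k k≢n)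

-- Compositions: the coefficients of (x/(1-x))^m

compositions : ℕ → ℕ → ℚ
compositions zero    i       = δ₀ i
compositions (suc m) zero    = 0ℚ
compositions (suc m) (suc i) = compositions (suc m) i + compositions m i

conv-shiftedGeometric-suc : ∀ f n → conv shiftedGeometric f (suc n) ≡ Σ≤ n (λ a → f (n ∸ a))
conv-shiftedGeometric-suc f n = begin
  conv shiftedGeometric f (suc n)                     ≡⟨ Σ≤-sucˡ n _ ⟩
  0ℚ * f (suc n) + Σ≤ n (λ a → 1ℚ * f (n ∸ a))        ≡⟨ cong (_+ Σ≤ n (λ a → 1ℚ * f (n ∸ a))) (ℚ.*-zeroˡ (f (suc n))) ⟩
  0ℚ + Σ≤ n (λ a → 1ℚ * f (n ∸ a))                    ≡⟨ ℚ.+-identityˡ _ ⟩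
  Σ≤ n (λ a → 1ℚ * f (n ∸ a))                         ≡⟨ Σ≤-cong n (λ a → ℚ.*-identityˡ (f (n ∸ a))) ⟩
  Σ≤ n (λ a → f (n ∸ a))                              ∎
  where open ≡-Reasoning

Σ≤-compositions : ∀ m n → Σ≤ n (λ a → compositions m (n ∸ a)) ≡ compositions (suc m) (suc n)
Σ≤-compositions m zero    = sym (ℚ.+-identityˡ (compositions m 0))
Σ≤-compositions m (suc n) = begin
  Σ≤ (suc n) (λ a → compositions m (suc n ∸ a))
    ≡⟨ Σ≤-sucˡ n _ ⟩
  compositions m (suc n) + Σ≤ n (λ a → compositions m (n ∸ a))
    ≡⟨ cong (λ x → compositions m (suc n) + x) (Σ≤-compositions m n) ⟩
  compositions m (suc n) + compositions (suc m) (suc n)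
    ≡⟨ ℚ.+-comm (compositions m (suc n)) _ ⟩
  compositions (suc m) (suc (suc n))
    ∎
  where open ≡-Reasoning

conv-shiftedGeometric-compositions : ∀ m → conv shiftedGeometric (compositions m) ≗ compositions (suc m)
conv-shiftedGeometric-compositions m zero    = ℚ.*-zeroˡ (compositions m 0)
conv-shiftedGeometric-compositions m (suc n) =
  trans (conv-shiftedGeometric-suc (compositions m) n) (Σ≤-compositions m n)

record Separable (P : PS) (f g : ℕ → ℚ) : Set where
  constructor separable
  field coeff : ∀ i j → P i j ≡ f i * g j

open Separable

⊛-separable : ∀ {P Q : PS} {f g f′ g′ F G : ℕ → ℚ} → Separable P f g → Separable Q f′ g′ →
              conv f f′ ≗ F → conv g g′ ≗ G → Separable (P ⊛ Q) F G
⊛-separable {P} {Q} {f} {g} {f′} {g′} {F} {G} P≗ Q≗ F≗ G≗ = separable λ i j → begin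
  (P ⊛ Q) i j
    ≡⟨ Σ≤-cong i (λ a → Σ≤-cong j (λ b → cong₂ _*_ (coeff P≗ a b) (coeff Q≗ (i ∸ a) (j ∸ b)))) ⟩
  Σ≤ i (λ a → Σ≤ j (λ b → (f a * g b) * (f′ (i ∸ a) * g′ (j ∸ b))))
    ≡⟨ Σ≤-cong i (λ a → Σ≤-cong j (λ b → *-interchange (f a) (g b) (f′ (i ∸ a)) (g′ (j ∸ b)))) ⟩
  Σ≤ i (λ a → Σ≤ j (λ b → (f a * f′ (i ∸ a)) * (g b * g′ (j ∸ b))))
    ≡⟨ Σ≤-*-Σ≤ i j _ _ ⟩
  conv f f′ i * conv g g′ j
    ≡⟨ cong₂ _*_ (F≗ i) (G≗ j) ⟩
  F i * G j
    ∎
  where open ≡-Reasoning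

⊛-zeroˡ : ∀ {P : PS} Q → (∀ i j → P i j ≡ 0ℚ) → ∀ i j → (P ⊛ Q) i j ≡ 0ℚ
⊛-zeroˡ {P} Q P≗0 i j = Σ≤-zero i _ λ a _ → Σ≤-zero j _ λ b _ →
  trans (cong (_* Q (i ∸ a) (j ∸ b)) (P≗0 a b)) (ℚ.*-zeroˡ (Q (i ∸ a) (j ∸ b)))

⊛-zeroʳ : ∀ P {Q : PS} → (∀ i j → Q i j ≡ 0ℚ) → ∀ i j → (P ⊛ Q) i j ≡ 0ℚ
⊛-zeroʳ P {Q} Q≗0 i j = Σ≤-zero i _ λ a _ → Σ≤-zero j _ λ b _ →
  trans (cong (P a b *_) (Q≗0 (i ∸ a) (j ∸ b))) (ℚ.*-zeroʳ (P a b))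

onePS-separable : Separable onePS δ₀ δ₀
onePS-separable = separable coeffs
  where
  coeffs : ∀ i j → onePS i j ≡ δ₀ i * δ₀ j
  coeffs zero    zero    = refl
  coeffs zero    (suc j) = refl
  coeffs (suc i) zero    = refl
  coeffs (suc i) (suc j) = refl

αPS-separable : Separable αPS δ₁ δ₀
αPS-separable = separable coeffs
  where
  coeffs : ∀ i j → αPS i j ≡ δ₁ i * δ₀ j
  coeffs zero          zero    = refl
  coeffs zero          (suc j) = refl
  coeffs (suc zero)    zero    = refl
  coeffs (suc zero)    (suc j) = refl
  coeffs (suc (suc i)) zero    = refl
  coeffs (suc (suc i)) (suc j) = refl

βPS-separable : Separable βPS δ₀ δ₁
βPS-separable = separable coeffs
  where
  coeffs : ∀ i j → βPS i j ≡ δ₀ i * δ₁ j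
  coeffs zero    zero          = refl
  coeffs zero    (suc zero)    = refl
  coeffs zero    (suc (suc j)) = refl
  coeffs (suc i) zero          = refl
  coeffs (suc i) (suc zero)    = refl
  coeffs (suc i) (suc (suc j)) = refl

inv1-α-separable : Separable inv1-α geometric δ₀
inv1-α-separable = separable coeffs
  where
  coeffs : ∀ i j → inv1-α i j ≡ geometric i * δ₀ j
  coeffs i zero    = refl
  coeffs i (suc j) = refl

inv1-β-separable : Separable inv1-β δ₀ geometric
inv1-β-separable = separable coeffs
  where
  coeffs : ∀ i j → inv1-β i j ≡ δ₀ i * geometric j
  coeffs zero    j = refl
  coeffs (suc i) j = refl

ratioPS-separable : Separable ratioPS shiftedGeometric shiftedGeometric
ratioPS-separable =
  ⊛-separable
    (⊛-separable αPS-separable βPS-separable (conv-identityʳ δ₁) (conv-identityˡ δ₁))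
    (⊛-separable inv1-α-separable inv1-β-separable (conv-identityʳ geometric) (conv-identityˡ geometric))
    conv-δ₁-geometric conv-δ₁-geometric

⊛-compositions : ∀ m {P Q : PS} → Separable P shiftedGeometric shiftedGeometric →
                 Separable Q (compositions m) (compositions m) →
                 Separable (P ⊛ Q) (compositions (suc m)) (compositions (suc m))
⊛-compositions m P≗ Q≗ =
  ⊛-separable P≗ Q≗ (conv-shiftedGeometric-compositions m) (conv-shiftedGeometric-compositions m)

powPS-ratioPS : ∀ m → Separable (powPS ratioPS m) (compositions m) (compositions m)
powPS-ratioPS zero    = onePS-separable
powPS-ratioPS (suc m) = ⊛-compositions m ratioPS-separable (powPS-ratioPS m)

transfer₀₀ : Separable ((A1∞ ⊗ A0∞) Fin.zero Fin.zero) shiftedGeometric shiftedGeometric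
transfer₀₀ = separable λ i j →
  trans (cong₂ _+_ (⊛-zeroˡ onePS (λ _ _ → refl) i j) (coeff β/[1-α]⊛α/[1-β] i j))
        (ℚ.+-identityˡ _)
  where
  β/[1-α]⊛α/[1-β] : Separable ((βPS ⊛ inv1-α) ⊛ (αPS ⊛ inv1-β)) shiftedGeometric shiftedGeometric
  β/[1-α]⊛α/[1-β] =
    ⊛-separable
      (⊛-separable βPS-separable inv1-α-separable (conv-identityˡ geometric) (conv-identityʳ δ₁))
      (⊛-separable αPS-separable inv1-β-separable (conv-identityʳ δ₁) (conv-identityˡ geometric))
      conv-geometric-δ₁ conv-δ₁-geometric

transfer₀₁ : ∀ i j → (A1∞ ⊗ A0∞) Fin.zero (Fin.suc Fin.zero) i j ≡ 0ℚ
transfer₀₁ i j = cong₂ _+_ (⊛-zeroˡ zeroPS (λ _ _ → refl) i j) (⊛-zeroʳ (βPS ⊛ inv1-α) (λ _ _ → refl) i j)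

γ∞-separable : ∀ m → Separable (γ∞ m) (compositions m) (compositions m)
γ∞-separable zero    = onePS-separable
γ∞-separable (suc m) = separable λ i j →
  trans (cong₂ _+_ (coeff (⊛-compositions m transfer₀₀ (γ∞-separable m)) i j)
                   (⊛-zeroˡ (((A1∞ ⊗ A0∞) ^M m) (Fin.suc Fin.zero) Fin.zero) transfer₀₁ i j))
        (ℚ.+-identityʳ _)

0≤ᵇ⊖ : ∀ i j → (+ 0 ℤ.≤ᵇ i ℤ.⊖ j) ≡ (j ℕ.≤ᵇ i)
0≤ᵇ⊖ i       zero    = cong (+ 0 ℤ.≤ᵇ_) (ℤ.⊖-≥ {i} {0} z≤n)
0≤ᵇ⊖ zero    (suc j) = refl
0≤ᵇ⊖ (suc i) (suc j) =
  trans (cong (+ 0 ℤ.≤ᵇ_) (ℤ.[1+m]⊖[1+n]≡m⊖n i j)) (trans (0≤ᵇ⊖ i j) (≤ᵇ-suc j))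
  where
  ≤ᵇ-suc : ∀ j → (j ℕ.≤ᵇ i) ≡ (suc j ℕ.≤ᵇ suc i)
  ≤ᵇ-suc zero    = refl
  ≤ᵇ-suc (suc j) = refl

BTerm≡cTerm : ∀ m i j → BTerm m (+ 0) i j ≡ cTerm m i j
BTerm≡cTerm m i j rewrite ℤ.m-n≡m⊖n i j | 0≤ᵇ⊖ i j | coeff (powPS-ratioPS m) i j | coeff (γ∞-separable m) i j = refl

box-cong : ∀ {f g : ℕ → ℕ → ℚ} → (∀ i j → f i j ≡ g i j) → ∀ N → box f N ≡ box g N
box-cong f≡g N = Σ≤-cong N (λ i → Σ≤-cong N (f≡g i))

SumEq-pointwise : ∀ {f g : ℕ → ℕ → ℚ} → (∀ i j → f i j ≡ g i j) → SumEq f g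
SumEq-pointwise f≡g = (λ N → N , ℚ.≤-reflexive (box-cong f≡g N))
                    , (λ N → N , ℚ.≤-reflexive (sym (box-cong f≡g N)))

lowerTriangle : (ℕ → ℚ) → ℕ → ℕ → ℚ
lowerTriangle v i j = if j ℕ.≤ᵇ i then v i * v j else 0ℚ

lowerTriangle-≤ : ∀ v {i j} → j ≤ i → lowerTriangle v i j ≡ v i * v j
lowerTriangle-≤ v {i} {j} j≤i with j ℕ.≤ᵇ i | ℕ.≤ᵇ-reflects-≤ j i
... | true  | _       = refl
... | false | ofⁿ j≰i = ⊥-elim (j≰i j≤i)

lowerTriangle-> : ∀ v {i j} → i < j → lowerTriangle v i j ≡ 0ℚ
lowerTriangle-> v {i} {j} i<j with j ℕ.≤ᵇ i | ℕ.≤ᵇ-reflects-≤ j i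
... | false | _       = refl
... | true  | ofʸ j≤i = ⊥-elim (ℕ.<⇒≱ i<j j≤i)

box-lowerTriangle : ∀ v N → box (lowerTriangle v) N ≡ Σ≤ N (λ i → v i * Σ≤ i v)
box-lowerTriangle v N = Σ≤-congᵇ N row
  where
  row : ∀ i → i ≤ N → Σ≤ N (lowerTriangle v i) ≡ v i * Σ≤ i v
  row i i≤N = begin
    Σ≤ N (lowerTriangle v i)  ≡⟨ Σ≤-truncate N i _ i≤N (λ j → lowerTriangle-> v) ⟩
    Σ≤ i (lowerTriangle v i)  ≡⟨ Σ≤-congᵇ i (λ j → lowerTriangle-≤ v) ⟩
    Σ≤ i (λ j → v i * v j)    ≡⟨ *-distribˡ-Σ≤ i (v i) v ⟨
    v i * Σ≤ i v              ∎
    where open ≡-Reasoning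

twice-Σ≤-*-prefix : ∀ N (v : ℕ → ℚ) →
  Σ≤ N (λ i → v i * Σ≤ i v) + Σ≤ N (λ i → v i * Σ≤ i v) ≡ Σ≤ N v * Σ≤ N v + Σ≤ N (λ i → v i * v i)
twice-Σ≤-*-prefix zero    v = refl
twice-Σ≤-*-prefix (suc N) v = begin
  (T + a * (S + a)) + (T + a * (S + a))    ≡⟨ +-interchange T _ T _ ⟩
  (T + T) + (a * (S + a) + a * (S + a))   ≡⟨ cong (_+ (a * (S + a) + a * (S + a))) (twice-Σ≤-*-prefix N v) ⟩
  (S * S + D) + (a * (S + a) + a * (S + a)) ≡⟨ square-step S a D ⟩
  (S + a) * (S + a) + (D + a * a)          ∎
  where
  open ≡-Reasoning
  open +-*-Solver
  T = Σ≤ N (λ i → v i * Σ≤ i v)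
  S = Σ≤ N v
  D = Σ≤ N (λ i → v i * v i)
  a = v (suc N)
  square-step : ∀ x y d → (x * x + d) + (y * (x + y) + y * (x + y)) ≡ (x + y) * (x + y) + (d + y * y)
  square-step = solve 3 (λ x y d → (x :* x :+ d) :+ (y :* (x :+ y) :+ y :* (x :+ y))
                                   := (x :+ y) :* (x :+ y) :+ (d :+ y :* y)) refl

-- Waiting time for the m-th head of a fair coin

negBin : ℕ → ℕ → ℚ
negBin m i = ½^ i * compositions m i

negBinCDF : ℕ → ℕ → ℚ
negBinCDF m N = Σ≤ N (negBin m)

½^-+ : ∀ i j → ½^ (i ℕ.+ j) ≡ ½^ i * ½^ j
½^-+ zero    j = sym (ℚ.*-identityˡ (½^ j))
½^-+ (suc i) j = trans (cong (½ *_) (½^-+ i j)) (sym (ℚ.*-assoc ½ (½^ i) (½^ j)))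

½^-nonNeg : ∀ i → 0ℚ ≤ℚ ½^ i
½^-nonNeg zero    = toWitness {a? = 0ℚ ℚ.≤? 1ℚ} _
½^-nonNeg (suc i) = 0≤* (toWitness {a? = 0ℚ ℚ.≤? ½} _) (½^-nonNeg i)

½^≤1 : ∀ i → ½^ i ≤ℚ 1ℚ
½^≤1 zero    = ℚ.≤-refl
½^≤1 (suc i) = ℚ.≤-trans (ℚ.*-monoˡ-≤-nonNeg ½ (½^≤1 i)) (toWitness {a? = ½ * 1ℚ ℚ.≤? 1ℚ} _)

compositions-< : ∀ m i → i < m → compositions m i ≡ 0ℚ
compositions-< (suc m) zero    _         = refl
compositions-< (suc m) (suc i) (s≤s i<m) =
  cong₂ _+_ (compositions-< (suc m) i (ℕ.m<n⇒m<1+n i<m)) (compositions-< m i i<m)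

compositions-diagonal : ∀ m → compositions m m ≡ 1ℚ
compositions-diagonal zero    = refl
compositions-diagonal (suc m) =
  trans (cong₂ _+_ (compositions-< (suc m) m (ℕ.n<1+n m)) (compositions-diagonal m)) (ℚ.+-identityˡ 1ℚ)

negBin-diagonal : ∀ m → negBin m m ≡ ½^ m
negBin-diagonal m = trans (cong (½^ m *_) (compositions-diagonal m)) (ℚ.*-identityʳ (½^ m))

negBinCDF-zero : ∀ N → negBinCDF 0 N ≡ 1ℚ
negBinCDF-zero zero    = refl
negBinCDF-zero (suc N) =
  trans (cong₂ _+_ (negBinCDF-zero N) (ℚ.*-zeroʳ (½^ (suc N)))) (ℚ.+-identityʳ 1ℚ)

-- The first toss is a head with probability ½.
negBinCDF-suc : ∀ m N → negBinCDF (suc m) (suc N) ≡ ½ * negBinCDF (suc m) N + ½ * negBinCDF m N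
negBinCDF-suc m N = begin
  negBinCDF (suc m) (suc N)
    ≡⟨ Σ≤-sucˡ N (negBin (suc m)) ⟩
  1ℚ * 0ℚ + Σ≤ N (λ i → (½ * ½^ i) * (compositions (suc m) i + compositions m i))
    ≡⟨ ℚ.+-identityˡ _ ⟩
  Σ≤ N (λ i → (½ * ½^ i) * (compositions (suc m) i + compositions m i))
    ≡⟨ Σ≤-cong N (λ i → split ½ (½^ i) (compositions (suc m) i) (compositions m i)) ⟩
  Σ≤ N (λ i → ½ * negBin (suc m) i + ½ * negBin m i)
    ≡⟨ Σ≤-distrib-+ N _ _ ⟩
  Σ≤ N (λ i → ½ * negBin (suc m) i) + Σ≤ N (λ i → ½ * negBin m i)
    ≡⟨ cong₂ _+_ (*-distribˡ-Σ≤ N ½ (negBin (suc m))) (*-distribˡ-Σ≤ N ½ (negBin m)) ⟨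
  ½ * negBinCDF (suc m) N + ½ * negBinCDF m N
    ∎
  where
  open ≡-Reasoning
  open +-*-Solver
  split : ∀ c h a b → (c * h) * (a + b) ≡ c * (h * a) + c * (h * b)
  split = solve 4 (λ c h a b → (c :* h) :* (a :+ b) := c :* (h :* a) :+ c :* (h :* b)) refl

¾ : ℚ
¾ = + 3 / 4

¾^-nonNeg : ∀ N → 0ℚ ≤ℚ ¾ ^ N
¾^-nonNeg zero    = toWitness {a? = 0ℚ ℚ.≤? 1ℚ} _
¾^-nonNeg (suc N) = 0≤* (toWitness {a? = 0ℚ ℚ.≤? ¾} _) (¾^-nonNeg N)

-- Scaled by ½^m, the mass beyond toss N obeys the recursion of negBinCDF-suc with ½ + ¼ = ¾.
negBinCDF-deficit : ∀ m N → ½^ m * (1ℚ - negBinCDF m N) ≤ℚ ¾ ^ N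
negBinCDF-deficit zero N = begin
  1ℚ * (1ℚ - negBinCDF 0 N)  ≡⟨ cong (λ s → 1ℚ * (1ℚ - s)) (negBinCDF-zero N) ⟩
  0ℚ                          ≤⟨ ¾^-nonNeg N ⟩
  ¾ ^ N                       ∎
  where open ℚ.≤-Reasoning
negBinCDF-deficit (suc m) zero = begin
  ½^ (suc m) * 1ℚ  ≡⟨ ℚ.*-identityʳ (½^ (suc m)) ⟩
  ½^ (suc m)       ≤⟨ ½^≤1 (suc m) ⟩
  1ℚ               ∎
  where open ℚ.≤-Reasoning
negBinCDF-deficit (suc m) (suc N) = begin
  (½ * h) * (1ℚ - negBinCDF (suc m) (suc N))
    ≡⟨ cong (λ s → (½ * h) * (1ℚ - s)) (negBinCDF-suc m N) ⟩
  (½ * h) * (1ℚ - (½ * a + ½ * b))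
    ≡⟨ regroup h a b ⟩
  ½ * ((½ * h) * (1ℚ - a)) + (½ * ½) * (h * (1ℚ - b))
    ≤⟨ ℚ.+-mono-≤ (ℚ.*-monoˡ-≤-nonNeg ½ (negBinCDF-deficit (suc m) N))
                  (ℚ.*-monoˡ-≤-nonNeg (½ * ½) (negBinCDF-deficit m N)) ⟩
  ½ * ¾ ^ N + (½ * ½) * ¾ ^ N
    ≡⟨ collect (¾ ^ N) ⟩
  ¾ * ¾ ^ N
    ∎
  where
  open ℚ.≤-Reasoning
  open +-*-Solver
  h = ½^ m
  a = negBinCDF (suc m) N
  b = negBinCDF m N
  regroup : ∀ h a b → (½ * h) * (1ℚ - (½ * a + ½ * b)) ≡ ½ * ((½ * h) * (1ℚ - a)) + (½ * ½) * (h * (1ℚ - b))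
  regroup = solve 3 (λ h a b → (con ½ :* h) :* (con 1ℚ :- (con ½ :* a :+ con ½ :* b))
                               := con ½ :* ((con ½ :* h) :* (con 1ℚ :- a)) :+ (con ½ :* con ½) :* (h :* (con 1ℚ :- b))) refl
  collect : ∀ x → ½ * x + (½ * ½) * x ≡ ¾ * x
  collect = solve 1 (λ x → con ½ :* x :+ (con ½ :* con ½) :* x := con ¾ :* x) refl

cutoff : ℕ → ℕ
cutoff m = m ℕ.* 8 ℕ.+ 3

m≤cutoff : ∀ m → m ≤ cutoff m
m≤cutoff m = ℕ.≤-trans (ℕ.m≤m*n m 8) (ℕ.m≤m+n (m ℕ.* 8) 3)

-- Raising m by 1 adds 8 to the cutoff, and (3/4)^8 < 1/8.
¾^cutoff<⅛^ : ∀ m → ¾ ^ cutoff m + ¾ ^ cutoff m <ℚ ½^ m * (½^ m * ½^ m)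
¾^cutoff<⅛^ zero    = toWitness {a? = ¾ ^ 3 + ¾ ^ 3 ℚ.<? 1ℚ * (1ℚ * 1ℚ)} _
¾^cutoff<⅛^ (suc m) = begin-strict
  ¾^8 x + ¾^8 x       ≡⟨ factor x ⟩
  ¾ ^ 8 * (x + x)     ≤⟨ ℚ.*-monoʳ-≤-nonNeg (x + x) {{nonNegative (ℚ.+-mono-≤ 0≤x 0≤x)}} ¾^8≤⅛ ⟩
  ⅛ * (x + x)         <⟨ ℚ.*-monoʳ-<-pos ⅛ (¾^cutoff<⅛^ m) ⟩
  ⅛ * (h * (h * h))   ≡⟨ cube h ⟩
  (½ * h) * ((½ * h) * (½ * h)) ∎
  where
  open ℚ.≤-Reasoning
  open +-*-Solver
  ⅛ = + 1 / 8
  x = ¾ ^ cutoff m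
  h = ½^ m
  0≤x = ¾^-nonNeg (cutoff m)
  ¾^8≤⅛ : ¾ ^ 8 ≤ℚ ⅛
  ¾^8≤⅛ = toWitness {a? = ¾ ^ 8 ℚ.≤? ⅛} _
  ¾^8 : ℚ → ℚ
  ¾^8 y = ¾ * (¾ * (¾ * (¾ * (¾ * (¾ * (¾ * (¾ * y)))))))
  factor : ∀ y → ¾^8 y + ¾^8 y ≡ ¾ ^ 8 * (y + y)
  factor = solve 1 (λ y → let t = λ z → con ¾ :* (con ¾ :* (con ¾ :* (con ¾ :* (con ¾ :* (con ¾ :* (con ¾ :* (con ¾ :* z)))))))
                          in t y :+ t y := con (¾ ^ 8) :* (y :+ y)) refl
  cube : ∀ h → ⅛ * (h * (h * h)) ≡ (½ * h) * ((½ * h) * (½ * h))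
  cube = solve 1 (λ h → con ⅛ :* (h :* (h :* h)) := (con ½ :* h) :* ((con ½ :* h) :* (con ½ :* h))) refl

negBinCDF-cutoff-deficit : ∀ m → let d = 1ℚ - negBinCDF m (cutoff m) in d + d <ℚ ½^ m * ½^ m
negBinCDF-cutoff-deficit m = ℚ.*-cancelˡ-<-nonNeg (½^ m) {{nonNegative (½^-nonNeg m)}} (begin-strict
  ½^ m * (d + d)               ≡⟨ ℚ.*-distribˡ-+ (½^ m) d d ⟩
  ½^ m * d + ½^ m * d          ≤⟨ ℚ.+-mono-≤ (negBinCDF-deficit m (cutoff m)) (negBinCDF-deficit m (cutoff m)) ⟩
  ¾ ^ cutoff m + ¾ ^ cutoff m  <⟨ ¾^cutoff<⅛^ m ⟩
  ½^ m * (½^ m * ½^ m)         ∎)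
  where
  open ℚ.≤-Reasoning
  d = 1ℚ - negBinCDF m (cutoff m)

1-2[1-x]≤x² : ∀ x → 1ℚ - ((1ℚ - x) + (1ℚ - x)) ≤ℚ x * x
1-2[1-x]≤x² x = ℚ.≤-trans (p≤p+q (0≤x*x (1ℚ - x))) (ℚ.≤-reflexive (expand x))
  where
  open +-*-Solver
  expand : ∀ x → (1ℚ - ((1ℚ - x) + (1ℚ - x))) + (1ℚ - x) * (1ℚ - x) ≡ x * x
  expand = solve 1 (λ x → (con 1ℚ :- ((con 1ℚ :- x) :+ (con 1ℚ :- x))) :+ (con 1ℚ :- x) :* (con 1ℚ :- x)
                          := x :* x) refl

cTerm-lowerTriangle : ∀ m i j → cTerm m i j ≡ lowerTriangle (negBin m) i j
cTerm-lowerTriangle m i j = cong (λ x → if j ℕ.≤ᵇ i then x else 0ℚ) (begin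
  ½^ (i ℕ.+ j) * γ∞ m i j                                  ≡⟨ cong₂ _*_ (½^-+ i j) (coeff (γ∞-separable m) i j) ⟩
  (½^ i * ½^ j) * (compositions m i * compositions m j)    ≡⟨ *-interchange (½^ i) (½^ j) _ _ ⟩
  negBin m i * negBin m j                                  ∎)
  where open ≡-Reasoning

½<box-cTerm : ∀ m → ½ <ℚ box (cTerm m) (cutoff m)
½<box-cTerm m = ℚ.<-≤-trans (ℚ.*-monoʳ-<-pos ½ 1<B+B) (ℚ.≤-reflexive (half B))
  where
  open +-*-Solver
  N = cutoff m
  B = box (cTerm m) N
  S = negBinCDF m N
  d = 1ℚ - S
  half : ∀ x → ½ * (x + x) ≡ x
  half = solve 1 (λ x → con ½ :* (x :+ x) := x) refl
  split-1 : ∀ e → (1ℚ - e) + e ≡ 1ℚ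
  split-1 = solve 1 (λ e → (con 1ℚ :- e) :+ e := con 1ℚ) refl
  T = Σ≤ N (λ i → negBin m i * negBinCDF m i)
  B≡ : B ≡ T
  B≡ = trans (box-cong (cTerm-lowerTriangle m) N) (box-lowerTriangle (negBin m) N)
  1<B+B : 1ℚ <ℚ B + B
  1<B+B = begin-strict
    1ℚ                                       ≡⟨ split-1 (d + d) ⟨
    (1ℚ - (d + d)) + (d + d)                 <⟨ ℚ.+-monoʳ-< (1ℚ - (d + d)) (negBinCDF-cutoff-deficit m) ⟩
    (1ℚ - (d + d)) + ½^ m * ½^ m             ≤⟨ ℚ.+-mono-≤ (1-2[1-x]≤x² S) diagonal ⟩
    S * S + Σ≤ N (λ i → negBin m i * negBin m i)
                                             ≡⟨ twice-Σ≤-*-prefix N (negBin m) ⟨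
    T + T                                    ≡⟨ cong₂ _+_ B≡ B≡ ⟨
    B + B                                    ∎
    where
    open ℚ.≤-Reasoning
    diagonal : ½^ m * ½^ m ≤ℚ Σ≤ N (λ i → negBin m i * negBin m i)
    diagonal = ℚ.≤-trans (ℚ.≤-reflexive (sym (cong₂ _*_ (negBin-diagonal m) (negBin-diagonal m))))
                         (term≤Σ≤ N m (λ i → 0≤x*x (negBin m i)) (m≤cutoff m))

proposition5p3 : (m : ℕ) → 1 ≤ m → SumEq (BTerm m (+ 0)) (cTerm m) × SumGt (cTerm m) ½
proposition5p3 m _ = SumEq-pointwise (BTerm≡cTerm m) , (cutoff m , ½<box-cTerm m)
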